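{- For colour stretch $1+\varepsilon$ it is impossible to achieve bin stretch better than $1.69103$ for sufficiently small $\varepsilon$: for every $\alpha<1.69103$ there is $\varepsilon_0>0$ such that for every $0<\varepsilon\le\varepsilon_0$ it is not the case that every instance of the coloured bin packing problem admits an $(\alpha,1+\varepsilon)$-approximate packing.
   Context: Coloured bin packing: an instance $I$ is a finite set of items, each item $e$ having a size $s(e)\in(0,1]$ and a colour $c(e)\in C=\{1,\dots,m\}$; items are to be packed into unit-capacity bins (the total size of items in a bin is at most $1$). $I_c$ denotes the set of items of colour $c$. $\mathrm{OPT}(I)$ (resp. $\mathrm{OPT}(I_c)$) is the minimum number of bins needed to pack $I$ (resp. $I_c$). For a packing $P$ of $I$, $P(I)$ is the number of bins used and $P_c(I)$ is the number of bins containing at least one item of colour $c$. A packing is $(\alpha,\beta)$-approximate if $P(I)\le \alpha\,\mathrm{OPT}(I)+O(1)$ and $P_c(I)\le \beta\,\mathrm{OPT}(I_c)+O(1)$ for every colour $c$, where the additive constants are independent of the instance.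
   Formalization: The bin stretch α and the parameter ε range over the rationals, and the item sizes $s(e)$ are taken in the rationals. -}

module Defs where

open import Data.Nat as ℕ using (ℕ; zero; suc)
open import Data.Fin using (Fin; zero; suc)
open import Data.Fin.Properties using (any?) renaming (_≟_ to _≟ᶠ_)
open import Data.Bool using (Bool; true; false)
open import Data.List using (List; length; lookup; filter)
open import Data.Product using (Σ; ∃; _×_; _,_)
open import Relation.Nullary using (Dec; yes; no; ¬_)
open import Relation.Nullary.Decidable using (⌊_⌋; _×-dec_)
open import Relation.Binary.PropositionalEquality using (_≡_)
open import Data.Rational using (ℚ; 0ℚ; _≤_; _<_; _+_; _*_; _/_)
open import Data.Integer using (+_)

record Item : Set where
  constructor item
  field
    size     : ℚ
    colour   : ℕ
    size-pos : 0ℚ < size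
    size-≤1  : size ≤ (+ 1 / 1)
open Item public

Instance : Set
Instance = List Item

ℕ→ℚ : ℕ → ℚ
ℕ→ℚ n = + n / 1

sumFin : (n : ℕ) → (Fin n → ℚ) → ℚ
sumFin zero    f = 0ℚ
sumFin (suc n) f = f zero + sumFin n (λ i → f (suc i))

countFin : (k : ℕ) → (Fin k → Bool) → ℕ
countFin zero    p = 0
countFin (suc k) p with p zero
... | true  = suc (countFin k (λ i → p (suc i)))
... | false = countFin k (λ i → p (suc i))

itemAt : (I : Instance) → Fin (length I) → Item
itemAt I = lookup I

Dec-size : {A : Set} → Dec A → ℚ → ℚ
Dec-size (yes _) q = q
Dec-size (no _)  q = 0ℚ

record Packing (I : Instance) : Set where
  constructor packing
  field
    nbins    : ℕ
    assign   : Fin (length I) → Fin nbins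
    capacity : (b : Fin nbins) →
               sumFin (length I)
                 (λ i → Dec-size (assign i ≟ᶠ b) (size (itemAt I i))) ≤ (+ 1 / 1)
open Packing public

binsUsed : {I : Instance} → Packing I → ℕ
binsUsed {I} P =
  countFin (nbins P) (λ b → ⌊ any? (λ i → assign P i ≟ᶠ b) ⌋)

binsWithColour : {I : Instance} → Packing I → ℕ → ℕ
binsWithColour {I} P c =
  countFin (nbins P)
    (λ b → ⌊ any? (λ i → (assign P i ≟ᶠ b) ×-dec (colour (itemAt I i) ℕ.≟ c)) ⌋)

restrict : Instance → ℕ → Instance
restrict I c = filter (λ e → colour e ℕ.≟ c) I

IsOPT : Instance → ℕ → Set
IsOPT I o = (Σ (Packing I) λ P → binsUsed P ≡ o)
          × ((P : Packing I) → o ℕ.≤ binsUsed P)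

IsApprox : ℚ → ℚ → ℕ → ℕ → (I : Instance) → Packing I → Set
IsApprox α β a b I P =
    ((o : ℕ) → IsOPT I o → ℕ→ℚ (binsUsed P) ≤ α * ℕ→ℚ o + ℕ→ℚ a)
  × ((c : ℕ) (o : ℕ) → IsOPT (restrict I c) o →
       ℕ→ℚ (binsWithColour P c) ≤ β * ℕ→ℚ o + ℕ→ℚ b)

AllAdmitApprox : ℚ → ℚ → Set
AllAdmitApprox α β =
  ∃ λ (a : ℕ) → ∃ λ (b : ℕ) → (I : Instance) → Σ (Packing I) λ P → IsApprox α β a b I P

module Submission where

open import Defs
open import Data.Rational using (ℚ; 0ℚ; 1ℚ; _≤_; _<_; _+_; _/_)
open import Data.Integer using (+_)
open import Data.Product using (∃; _×_)
open import Relation.Nullary using (¬_)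

-- Six colours: an item of colour i has size just above 1/tᵢ, where
-- t = 2, 3, 7, 43, 1807, 3263443 is Sylvester's sequence, so that exactly
-- K i + 1 = tᵢ − 1 items of colour i fit into a bin.  The instance instanceOf N
-- has N items of every colour; its optimum is N (one item of each colour per
-- bin), and when K i + 1 divides N the optimum of colour class i is N/(K i + 1).
-- Harmonic counting: in every bin at most one colour i has more than K i items,
-- since two such groups would overflow the bin; hence every packing P satisfies
--   6N ≤ P(I) + Σᵢ K i · P_i(I)                         (harmonic-count).
-- With N = M·Lc, Lc = lcm (K i + 1), the guarantees P(I) ≤ α·OPT + a and
-- P_i(I) ≤ β·OPT(I_i) + b turn this into 6Lc·M ≤ (α·Lc + β·Tn)·M + const for
-- all M, where Tn = Σᵢ K i · Lc/(K i + 1); so α·Lc + β·Tn ≥ 6Lc (ratio-bound).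
-- As 6Lc − Tn > 1.69103·Lc, this fails for α < 1.69103 and β = 1 + ε, ε small.

open import Data.Rational using (mkℚ; *≤*; *<*; _-_; -_; _*_; 1/_; toℚᵘ; Positive; NonNegative; positive)
import Data.Rational.Properties as ℚP
import Data.Rational.Unnormalised as ℚᵘ
import Data.Rational.Unnormalised.Properties as ℚᵘP
open import Data.Rational.Solver using (module +-*-Solver)
import Data.Integer as ℤ
import Data.Integer.Properties as ℤP
open import Data.Nat as ℕ using (ℕ; zero; suc; z≤n; s≤s; NonZero; _∸_)
  renaming (_+_ to _+ₙ_; _*_ to _*ₙ_; _≤_ to _≤ₙ_; _<_ to _<ₙ_)
import Data.Nat.Properties as ℕP
open import Data.Nat.Coprimality using (1-coprimeTo) renaming (sym to coprime-sym)
open import Data.Bool using (Bool; true; false)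
open import Data.Fin using (Fin; zero; suc; toℕ)
open import Data.Fin.Properties using (any?; all?; suc-injective; toℕ-injective) renaming (_≟_ to _≟ᶠ_)
open import Data.List using (List; []; _∷_; _++_; length; replicate; concat; tabulate)
open import Data.List.Properties using (length-replicate; filter-++)
open import Data.List.Relation.Unary.All using (All; []; _∷_)
import Data.List.Relation.Unary.All as All
open import Data.List.Relation.Unary.All.Properties using (replicate⁺; concat⁺; tabulate⁺)
open import Data.List.Membership.Propositional.Properties using (∈-lookup)
open import Data.Product using (_,_; proj₁; proj₂)
open import Data.Empty using (⊥-elim)
open import Function using (_∘_)
open import Level using (0ℓ)
open import Relation.Nullary using (Dec; yes; no; contradiction)
open import Relation.Nullary.Decidable using (⌊_⌋; _×-dec_; True; toWitness; from-yes; ⌊⌋-map′)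
open import Relation.Unary using (Pred; Decidable)
open import Relation.Binary.PropositionalEquality
  using (_≡_; _≢_; refl; sym; trans; cong; cong₂; subst; subst₂; module ≡-Reasoning)
open import Algebra.Properties.Semiring.Sum ℕP.+-*-semiring
  using (sum; ∑-comm; ∑-distrib-+; *-distribˡ-sum; *-distribʳ-sum; sum-replicate-zero; sum-cong-≗)
open import Algebra.Properties.CommutativeSemigroup ℕP.*-commutativeSemigroup using (x∙yz≈y∙xz)

ℕ→ℚ≡mkℚ : ∀ n → ℕ→ℚ n ≡ mkℚ (+ n) 0 (coprime-sym (1-coprimeTo n))
ℕ→ℚ≡mkℚ n = ℚP.normalize-coprime (coprime-sym (1-coprimeTo n))

ℕ→ℚ-mono : ∀ {m n} → m ≤ₙ n → ℕ→ℚ m ≤ ℕ→ℚ n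
ℕ→ℚ-mono {m} {n} m≤n rewrite ℕ→ℚ≡mkℚ m | ℕ→ℚ≡mkℚ n =
  *≤* (subst₂ ℤ._≤_ (sym (ℤP.*-identityʳ (+ m))) (sym (ℤP.*-identityʳ (+ n))) (ℤ.+≤+ m≤n))

ℕ→ℚ-cancel : ∀ {m n} → ℕ→ℚ m ≤ ℕ→ℚ n → m ≤ₙ n
ℕ→ℚ-cancel {m} {n} q≤ rewrite ℕ→ℚ≡mkℚ m | ℕ→ℚ≡mkℚ n with q≤
... | *≤* k with subst₂ ℤ._≤_ (ℤP.*-identityʳ (+ m)) (ℤP.*-identityʳ (+ n)) k
...   | ℤ.+≤+ m≤n = m≤n

ℕ→ℚ-nonNeg : ∀ n → NonNegative (ℕ→ℚ n)
ℕ→ℚ-nonNeg n rewrite ℕ→ℚ≡mkℚ n = _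

ℕ→ℚ-pos : ∀ n .{{_ : NonZero n}} → Positive (ℕ→ℚ n)
ℕ→ℚ-pos (suc n) rewrite ℕ→ℚ≡mkℚ (suc n) = _

-- On unnormalised rationals the embedding is n ↦ n/1, where + and * are computed exactly.
toℚᵘ-ℕ→ℚ : ∀ n → toℚᵘ (ℕ→ℚ n) ≡ ℚᵘ.mkℚᵘ (+ n) 0
toℚᵘ-ℕ→ℚ n rewrite ℕ→ℚ≡mkℚ n = refl

ℕ→ℚ-+ : ∀ m n → ℕ→ℚ (m +ₙ n) ≡ ℕ→ℚ m + ℕ→ℚ n
ℕ→ℚ-+ m n = ℚP.toℚᵘ-injective (begin
  toℚᵘ (ℕ→ℚ (m +ₙ n))                      ≡⟨ toℚᵘ-ℕ→ℚ (m +ₙ n) ⟩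
  ℚᵘ.mkℚᵘ (+ (m +ₙ n)) 0                    ≈⟨ ℚᵘ.*≡* (cong (ℤ._* + 1) (sym (cong₂ ℤ._+_ (ℤP.*-identityʳ (+ m)) (ℤP.*-identityʳ (+ n))))) ⟩
  ℚᵘ.mkℚᵘ (+ m) 0 ℚᵘ.+ ℚᵘ.mkℚᵘ (+ n) 0      ≡⟨ sym (cong₂ ℚᵘ._+_ (toℚᵘ-ℕ→ℚ m) (toℚᵘ-ℕ→ℚ n)) ⟩
  toℚᵘ (ℕ→ℚ m) ℚᵘ.+ toℚᵘ (ℕ→ℚ n)            ≈⟨ ℚᵘP.≃-sym (ℚP.toℚᵘ-homo-+ (ℕ→ℚ m) (ℕ→ℚ n)) ⟩
  toℚᵘ (ℕ→ℚ m + ℕ→ℚ n)                      ∎)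
  where open ℚᵘP.≃-Reasoning

ℕ→ℚ-* : ∀ m n → ℕ→ℚ (m *ₙ n) ≡ ℕ→ℚ m * ℕ→ℚ n
ℕ→ℚ-* m n = ℚP.toℚᵘ-injective (begin
  toℚᵘ (ℕ→ℚ (m *ₙ n))                      ≡⟨ toℚᵘ-ℕ→ℚ (m *ₙ n) ⟩
  ℚᵘ.mkℚᵘ (+ (m *ₙ n)) 0                    ≈⟨ ℚᵘ.*≡* (cong (ℤ._* + 1) (ℤP.pos-* m n)) ⟩
  ℚᵘ.mkℚᵘ (+ m) 0 ℚᵘ.* ℚᵘ.mkℚᵘ (+ n) 0      ≡⟨ sym (cong₂ ℚᵘ._*_ (toℚᵘ-ℕ→ℚ m) (toℚᵘ-ℕ→ℚ n)) ⟩
  toℚᵘ (ℕ→ℚ m) ℚᵘ.* toℚᵘ (ℕ→ℚ n)            ≈⟨ ℚᵘP.≃-sym (ℚP.toℚᵘ-homo-* (ℕ→ℚ m) (ℕ→ℚ n)) ⟩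
  toℚᵘ (ℕ→ℚ m * ℕ→ℚ n)                      ∎)
  where open ℚᵘP.≃-Reasoning

ℕ→ℚ-unbounded : ∀ r → ∃ λ M → r < ℕ→ℚ M
ℕ→ℚ-unbounded (mkℚ (+ n) d c) = suc n , subst (mkℚ (+ n) d c <_) (sym (ℕ→ℚ≡mkℚ (suc n)))
  (*<* (ℤP.+◃-mono-< (subst (_<ₙ suc n *ₙ suc d) (sym (ℕP.*-identityʳ n)) (ℕP.m≤m*n (suc n) (suc d)))))
ℕ→ℚ-unbounded (mkℚ ℤ.-[1+ n ] d c) = 0 , *<* ℤ.-<+

sumFin-scale : ∀ k (c : ℚ) (f : Fin k → ℚ) (g : Fin k → ℕ) →
               (∀ i → c * f i ≡ ℕ→ℚ (g i)) → c * sumFin k f ≡ ℕ→ℚ (sum g)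
sumFin-scale zero    c f g _  = ℚP.*-zeroʳ c
sumFin-scale (suc k) c f g cf≡g = begin
  c * (f zero + sumFin k (f ∘ suc))       ≡⟨ ℚP.*-distribˡ-+ c (f zero) _ ⟩
  c * f zero + c * sumFin k (f ∘ suc)     ≡⟨ cong₂ _+_ (cf≡g zero) (sumFin-scale k c (f ∘ suc) (g ∘ suc) (cf≡g ∘ suc)) ⟩
  ℕ→ℚ (g zero) + ℕ→ℚ (sum (g ∘ suc))      ≡⟨ sym (ℕ→ℚ-+ (g zero) _) ⟩
  ℕ→ℚ (sum g)                             ∎
  where open ≡-Reasoning

sum-mono : ∀ {n} {f g : Fin n → ℕ} → (∀ i → f i ≤ₙ g i) → sum f ≤ₙ sum g
sum-mono {zero}  _   = z≤n
sum-mono {suc n} f≤g = ℕP.+-mono-≤ (f≤g zero) (sum-mono (f≤g ∘ suc))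

indicator : Bool → ℕ
indicator true  = 1
indicator false = 0

indicator-× : ∀ {A B : Set} (d₁ : Dec A) (d₂ : Dec B) →
              indicator ⌊ d₁ ×-dec d₂ ⌋ ≡ indicator ⌊ d₁ ⌋ *ₙ indicator ⌊ d₂ ⌋
indicator-× (yes _) (yes _) = refl
indicator-× (yes _) (no _)  = refl
indicator-× (no _)  _       = refl

countFin≡sum : ∀ k (p : Fin k → Bool) → countFin k p ≡ sum (indicator ∘ p)
countFin≡sum zero    p = refl
countFin≡sum (suc k) p with p zero
... | true  = cong suc (countFin≡sum k (p ∘ suc))
... | false = countFin≡sum k (p ∘ suc)

countFin-≤ : ∀ k (p : Fin k → Bool) → countFin k p ≤ₙ k
countFin-≤ zero    p = z≤n
countFin-≤ (suc k) p with p zero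
... | true  = s≤s (countFin-≤ k (p ∘ suc))
... | false = ℕP.m≤n⇒m≤1+n (countFin-≤ k (p ∘ suc))

count-equal : ∀ {m} (a : Fin m) → sum (λ b → indicator ⌊ a ≟ᶠ b ⌋) ≡ 1
count-equal {suc m} zero    = cong suc (sum-replicate-zero m)
count-equal {suc m} (suc a) =
  trans (sum-cong-≗ (λ b → cong indicator (⌊⌋-map′ _ _ (a ≟ᶠ b)))) (count-equal a)

count-none : ∀ {n} {P : Pred (Fin n) 0ℓ} (P? : Decidable P) → ¬ ∃ P → sum (λ x → indicator ⌊ P? x ⌋) ≡ 0
count-none {zero}  P? none = refl
count-none {suc n} P? none with P? zero
... | yes p = ⊥-elim (none (zero , p))
... | no _  = count-none (P? ∘ suc) (λ (x , p) → none (suc x , p))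

any-false⇒none : ∀ {n} {P : Pred (Fin n) 0ℓ} (P? : Decidable P) → ⌊ any? P? ⌋ ≡ false → ¬ ∃ P
any-false⇒none P? eq w with any? P?
... | yes _ = contradiction eq λ ()
... | no ¬w = ¬w w

sum-at-most-one : ∀ {n} (f : Fin n → ℕ) → (∀ i → f i ≤ₙ 1) →
                  (∀ i j → 0 <ₙ f i → 0 <ₙ f j → i ≡ j) → sum f ≤ₙ 1
sum-at-most-one {zero}  f ≤1 unique = z≤n
sum-at-most-one {suc n} f ≤1 unique with 0 ℕ.<? f zero
... | no  f₀≯0 = subst (λ t → t +ₙ sum (f ∘ suc) ≤ₙ 1) (sym (ℕP.n≤0⇒n≡0 (ℕP.≮⇒≥ f₀≯0)))
                   (sum-at-most-one (f ∘ suc) (≤1 ∘ suc)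
                     (λ i j p q → suc-injective (unique (suc i) (suc j) p q)))
... | yes f₀>0 = subst (λ t → f zero +ₙ t ≤ₙ 1) (sym rest≡0)
                   (subst (_≤ₙ 1) (sym (ℕP.+-identityʳ (f zero))) (≤1 zero))
  where
  others-zero : ∀ j → f (suc j) ≡ 0
  others-zero j = ℕP.n≤0⇒n≡0 (ℕP.≮⇒≥ (λ fⱼ>0 → contradiction (unique zero (suc j) f₀>0 fⱼ>0) λ ()))
  rest≡0 : sum (f ∘ suc) ≡ 0
  rest≡0 = trans (sum-cong-≗ others-zero) (sum-replicate-zero n)

colourCount : Instance → ℕ → ℕ
colourCount L c = sum (λ x → indicator ⌊ colour (itemAt L x) ℕ.≟ c ⌋)

colourCount-++ : ∀ L L′ c → colourCount (L ++ L′) c ≡ colourCount L c +ₙ colourCount L′ c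
colourCount-++ []      L′ c = refl
colourCount-++ (e ∷ L) L′ c =
  trans (cong (indicator ⌊ colour e ℕ.≟ c ⌋ +ₙ_) (colourCount-++ L L′ c))
        (sym (ℕP.+-assoc (indicator ⌊ colour e ℕ.≟ c ⌋) _ _))

colourCount-concat-replicate : ∀ m g c → colourCount (concat (replicate m g)) c ≡ m *ₙ colourCount g c
colourCount-concat-replicate zero    g c = refl
colourCount-concat-replicate (suc m) g c =
  trans (colourCount-++ g (concat (replicate m g)) c)
        (cong (colourCount g c +ₙ_) (colourCount-concat-replicate m g c))

colourCount-replicate : ∀ n e → colourCount (replicate n e) (colour e) ≡ n
colourCount-replicate zero    e = refl
colourCount-replicate (suc n) e =
  cong₂ _+ₙ_ (cong (indicator ∘ ⌊_⌋) (ℕP.≟-diag refl)) (colourCount-replicate n e)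

replicate-* : ∀ n k (e : Item) → replicate (n *ₙ k) e ≡ concat (replicate n (replicate k e))
replicate-* zero    k e = refl
replicate-* (suc n) k e = trans (replicate-+ k (n *ₙ k)) (cong (replicate k e ++_) (replicate-* n k e))
  where
  replicate-+ : ∀ i j → replicate (i +ₙ j) e ≡ replicate i e ++ replicate j e
  replicate-+ zero    j = refl
  replicate-+ (suc i) j = cong (e ∷_) (replicate-+ i j)

-- Instances whose item sizes are integer multiples W(c)/D of 1/D, the
-- multiple depending only on the colour c.  All bin capacities then become
-- inequalities between natural numbers.
module Scaled (D : ℕ) (W : ℕ → ℕ) where

  Weighted : Item → Set
  Weighted e = ℕ→ℚ D * size e ≡ ℕ→ℚ (W (colour e))

  weighted-at : ∀ {L} → All Weighted L → ∀ x → Weighted (itemAt L x)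
  weighted-at wf x = All.lookup wf (∈-lookup x)

  -- D times the size of the contents of bin b under the assignment a.
  load : (L : Instance) {m : ℕ} → (Fin (length L) → Fin m) → Fin m → ℕ
  load L a b = sum (λ x → indicator ⌊ a x ≟ᶠ b ⌋ *ₙ W (colour (itemAt L x)))

  load-scaled : ∀ {L} → All Weighted L → ∀ {m} (a : Fin (length L) → Fin m) b →
                ℕ→ℚ D * sumFin (length L) (λ x → Dec-size (a x ≟ᶠ b) (size (itemAt L x)))
                  ≡ ℕ→ℚ (load L a b)
  load-scaled {L} wf a b =
    sumFin-scale (length L) (ℕ→ℚ D) _ (λ x → indicator ⌊ a x ≟ᶠ b ⌋ *ₙ W (colour (itemAt L x)))
      (λ x → scaled (a x ≟ᶠ b) {itemAt L x} (weighted-at wf x))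
    where
    scaled : ∀ {A : Set} (d : Dec A) {e} → Weighted e →
             ℕ→ℚ D * Dec-size d (size e) ≡ ℕ→ℚ (indicator ⌊ d ⌋ *ₙ W (colour e))
    scaled (yes _) {e} w = trans w (cong ℕ→ℚ (sym (ℕP.+-identityʳ (W (colour e)))))
    scaled (no _)      _ = ℚP.*-zeroʳ (ℕ→ℚ D)

  load≤D : ∀ {L} → All Weighted L → (P : Packing L) → ∀ b → load L (assign P) b ≤ₙ D
  load≤D {L} wf P b = ℕ→ℚ-cancel (begin
    ℕ→ℚ (load L (assign P) b)
      ≡⟨ sym (load-scaled wf (assign P) b) ⟩
    ℕ→ℚ D * sumFin (length L) (λ x → Dec-size (assign P x ≟ᶠ b) (size (itemAt L x)))
      ≤⟨ ℚP.*-monoˡ-≤-nonNeg (ℕ→ℚ D) {{ℕ→ℚ-nonNeg D}} (capacity P b) ⟩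
    ℕ→ℚ D * 1ℚ
      ≡⟨ ℚP.*-identityʳ (ℕ→ℚ D) ⟩
    ℕ→ℚ D ∎)
    where open ℚP.≤-Reasoning

  packing-of-loads : {{_ : NonZero D}} → ∀ {L} → All Weighted L → ∀ {m} (a : Fin (length L) → Fin m) →
                     (∀ b → load L a b ≤ₙ D) → Packing L
  packing-of-loads {L} wf {m} a fits = packing m a λ b →
    ℚP.*-cancelˡ-≤-pos (ℕ→ℚ D) {{ℕ→ℚ-pos D}} (begin
      ℕ→ℚ D * sumFin (length L) (λ x → Dec-size (a x ≟ᶠ b) (size (itemAt L x)))
        ≡⟨ load-scaled wf a b ⟩
      ℕ→ℚ (load L a b)
        ≤⟨ ℕ→ℚ-mono (fits b) ⟩
      ℕ→ℚ D
        ≡⟨ sym (ℚP.*-identityʳ (ℕ→ℚ D)) ⟩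
      ℕ→ℚ D * 1ℚ ∎)
    where open ℚP.≤-Reasoning

  weight : Instance → ℕ
  weight []      = 0
  weight (e ∷ g) = W (colour e) +ₙ weight g

  prepend : (g L : Instance) {m : ℕ} → (Fin (length L) → Fin m) → Fin (length (g ++ L)) → Fin (suc m)
  prepend []      L a x       = suc (a x)
  prepend (e ∷ g) L a zero    = zero
  prepend (e ∷ g) L a (suc x) = prepend g L a x

  load-prepend-new : ∀ g L {m} (a : Fin (length L) → Fin m) →
                     load (g ++ L) (prepend g L a) zero ≡ weight g
  load-prepend-new []      L a = sum-replicate-zero (length L)
  load-prepend-new (e ∷ g) L a = cong₂ _+ₙ_ (ℕP.*-identityˡ (W (colour e))) (load-prepend-new g L a)

  load-prepend-old : ∀ g L {m} (a : Fin (length L) → Fin m) b →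
                     load (g ++ L) (prepend g L a) (suc b) ≡ load L a b
  load-prepend-old []      L a b =
    sum-cong-≗ (λ x → cong (λ t → indicator t *ₙ W (colour (itemAt L x))) (⌊⌋-map′ _ _ (a x ≟ᶠ b)))
  load-prepend-old (e ∷ g) L a b = load-prepend-old g L a b

  group-assign : (gs : List Instance) → Fin (length (concat gs)) → Fin (length gs)
  group-assign []       ()
  group-assign (g ∷ gs) = prepend g (concat gs) (group-assign gs)

  group-loads : ∀ gs → All (λ g → weight g ≤ₙ D) gs → ∀ b → load (concat gs) (group-assign gs) b ≤ₙ D
  group-loads []       []         ()
  group-loads (g ∷ gs) (fits ∷ _) zero =
    subst (_≤ₙ D) (sym (load-prepend-new g (concat gs) (group-assign gs))) fits
  group-loads (g ∷ gs) (_ ∷ fitss) (suc b) =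
    subst (_≤ₙ D) (sym (load-prepend-old g (concat gs) (group-assign gs) b)) (group-loads gs fitss b)

  group-packing : {{_ : NonZero D}} → ∀ gs → All Weighted (concat gs) →
                  All (λ g → weight g ≤ₙ D) gs → Packing (concat gs)
  group-packing gs wf fits = packing-of-loads wf (group-assign gs) (group-loads gs fits)

  module Bins {L : Instance} (P : Packing L) (wf : All Weighted L) where

    private
      col : Fin (length L) → ℕ
      col x = colour (itemAt L x)

    in-bin : Fin (nbins P) → ℕ → Fin (length L) → ℕ
    in-bin b c x = indicator ⌊ (assign P x ≟ᶠ b) ×-dec (col x ℕ.≟ c) ⌋

    count : Fin (nbins P) → ℕ → ℕ
    count b c = sum (in-bin b c)

    used : Fin (nbins P) → Bool
    used b = ⌊ any? (λ x → assign P x ≟ᶠ b) ⌋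

    has : Fin (nbins P) → ℕ → Bool
    has b c = ⌊ any? (λ x → (assign P x ≟ᶠ b) ×-dec (col x ℕ.≟ c)) ⌋

    binsUsed≡ : binsUsed P ≡ sum (indicator ∘ used)
    binsUsed≡ = countFin≡sum (nbins P) used

    binsWithColour≡ : ∀ c → binsWithColour P c ≡ sum (λ b → indicator (has b c))
    binsWithColour≡ c = countFin≡sum (nbins P) (λ b → has b c)

    -- Every item lies in exactly one bin, so the bin counts add up to the colour count.
    count-total : ∀ c → sum (λ b → count b c) ≡ colourCount L c
    count-total c = trans (∑-comm (λ b x → in-bin b c x)) (sum-cong-≗ in-one-bin)
      where
      in-one-bin : ∀ x → sum (λ b → in-bin b c x) ≡ indicator ⌊ col x ℕ.≟ c ⌋
      in-one-bin x = begin
        sum (λ b → in-bin b c x)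
          ≡⟨ sum-cong-≗ (λ b → indicator-× (assign P x ≟ᶠ b) (col x ℕ.≟ c)) ⟩
        sum (λ b → indicator ⌊ assign P x ≟ᶠ b ⌋ *ₙ indicator ⌊ col x ℕ.≟ c ⌋)
          ≡⟨ sym (*-distribʳ-sum _ (λ b → indicator ⌊ assign P x ≟ᶠ b ⌋)) ⟩
        sum (λ b → indicator ⌊ assign P x ≟ᶠ b ⌋) *ₙ indicator ⌊ col x ℕ.≟ c ⌋
          ≡⟨ cong (_*ₙ indicator ⌊ col x ℕ.≟ c ⌋) (count-equal (assign P x)) ⟩
        1 *ₙ indicator ⌊ col x ℕ.≟ c ⌋
          ≡⟨ ℕP.*-identityˡ _ ⟩
        indicator ⌊ col x ℕ.≟ c ⌋ ∎
        where open ≡-Reasoning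

    count-unused : ∀ b c → used b ≡ false → count b c ≡ 0
    count-unused b c unused = count-none (λ x → (assign P x ≟ᶠ b) ×-dec (col x ℕ.≟ c)) (λ (x , in-b , _) → any-false⇒none _ unused (x , in-b))

    count-absent : ∀ b c → has b c ≡ false → count b c ≡ 0
    count-absent b c absent = count-none (λ x → (assign P x ≟ᶠ b) ×-dec (col x ℕ.≟ c)) (any-false⇒none _ absent)

    two-colour-load : ∀ b c c′ → c ≢ c′ →
                      count b c *ₙ W c +ₙ count b c′ *ₙ W c′ ≤ₙ load L (assign P) b
    two-colour-load b c c′ c≢c′ = begin
      count b c *ₙ W c +ₙ count b c′ *ₙ W c′
        ≡⟨ cong₂ _+ₙ_ (*-distribʳ-sum (W c) (in-bin b c)) (*-distribʳ-sum (W c′) (in-bin b c′)) ⟩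
      sum (λ x → in-bin b c x *ₙ W c) +ₙ sum (λ x → in-bin b c′ x *ₙ W c′)
        ≡⟨ sym (∑-distrib-+ (λ x → in-bin b c x *ₙ W c) (λ x → in-bin b c′ x *ₙ W c′)) ⟩
      sum (λ x → in-bin b c x *ₙ W c +ₙ in-bin b c′ x *ₙ W c′)
        ≤⟨ sum-mono item-weight ⟩
      load L (assign P) b ∎
      where
      open ℕP.≤-Reasoning
      item-weight : ∀ x → in-bin b c x *ₙ W c +ₙ in-bin b c′ x *ₙ W c′
                            ≤ₙ indicator ⌊ assign P x ≟ᶠ b ⌋ *ₙ W (col x)
      item-weight x with assign P x ≟ᶠ b | col x ℕ.≟ c | col x ℕ.≟ c′
      ... | yes _ | yes refl | yes refl = contradiction refl c≢c′
      ... | yes _ | yes refl | no _     = ℕP.≤-reflexive (ℕP.+-identityʳ _)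
      ... | yes _ | no _     | yes refl = ℕP.≤-refl
      ... | yes _ | no _     | no _     = z≤n
      ... | no _  | _        | _        = z≤n

    colour-load : ∀ b c → count b c *ₙ W c ≤ₙ load L (assign P) b
    colour-load b c = ℕP.≤-trans (ℕP.m≤m+n _ _) (two-colour-load b c (suc c) (ℕP.1+n≢n ∘ sym))

    count-bound : ∀ c k → D <ₙ suc k *ₙ W c → ∀ b → count b c ≤ₙ k
    count-bound c k overflow b = ℕP.≮⇒≥ λ k<count → ℕP.<-irrefl refl (begin-strict
      D                        <⟨ overflow ⟩
      suc k *ₙ W c             ≤⟨ ℕP.*-monoˡ-≤ (W c) k<count ⟩
      count b c *ₙ W c         ≤⟨ colour-load b c ⟩
      load L (assign P) b      ≤⟨ load≤D wf P b ⟩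
      D                        ∎)
      where open ℕP.≤-Reasoning

    colour-bins : ∀ c k → D <ₙ suc k *ₙ W c → colourCount L c ≤ₙ k *ₙ binsUsed P
    colour-bins c k overflow = begin
      colourCount L c                    ≡⟨ sym (count-total c) ⟩
      sum (λ b → count b c)              ≤⟨ sum-mono per-bin ⟩
      sum (λ b → k *ₙ indicator (used b)) ≡⟨ sym (*-distribˡ-sum k (indicator ∘ used)) ⟩
      k *ₙ sum (indicator ∘ used)        ≡⟨ cong (k *ₙ_) (sym binsUsed≡) ⟩
      k *ₙ binsUsed P                    ∎
      where
      open ℕP.≤-Reasoning
      per-bin : ∀ b → count b c ≤ₙ k *ₙ indicator (used b)
      per-bin b with used b in eq
      ... | true  = subst (count b c ≤ₙ_) (sym (ℕP.*-identityʳ k)) (count-bound c k overflow b)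
      ... | false = ℕP.≤-reflexive (trans (count-unused b c eq) (sym (ℕP.*-zeroʳ k)))

  -- For colours i < n, K i + 1 items of colour i
  -- fit into a bin but K i + 2 do not, and K i + 1 of them weigh at least H with
  -- 2H > D.  So in each bin at most one colour i exceeds K i items, and by one only:
  -- every bin holds at most 1 + Σᵢ K i · [bin contains colour i] of these items.
  module Harmonic {n : ℕ} (K : Fin n → ℕ) (H : ℕ)
                  (overfull : ∀ i → D <ₙ suc (suc (K i)) *ₙ W (toℕ i))
                  (heavy : ∀ i → H ≤ₙ suc (K i) *ₙ W (toℕ i))
                  (two-heavy : D <ₙ H +ₙ H)
                  {L : Instance} (P : Packing L) (wf : All Weighted L) where

    open Bins P wf

    excess : Fin (nbins P) → Fin n → ℕ
    excess b i = count b (toℕ i) ∸ K i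

    excess≤1 : ∀ b i → excess b i ≤ₙ 1
    excess≤1 b i = ℕP.m≤n+o⇒m∸n≤o _ (K i)
      (subst (count b (toℕ i) ≤ₙ_) (ℕP.+-comm 1 (K i)) (count-bound (toℕ i) (suc (K i)) (overfull i) b))

    heavy-if-excess : ∀ b i → 0 <ₙ excess b i → H ≤ₙ count b (toℕ i) *ₙ W (toℕ i)
    heavy-if-excess b i excess>0 = ℕP.≤-trans (heavy i)
      (ℕP.*-monoˡ-≤ (W (toℕ i)) (ℕP.m∸n≢0⇒n<m {count b (toℕ i)} {K i} (λ eq → ℕP.<-irrefl (sym eq) excess>0)))

    one-excess : ∀ b i j → 0 <ₙ excess b i → 0 <ₙ excess b j → i ≡ j
    one-excess b i j excessᵢ excessⱼ with i ≟ᶠ j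
    ... | yes i≡j = i≡j
    ... | no  i≢j = contradiction (begin-strict
      D                                                        <⟨ two-heavy ⟩
      H +ₙ H                                                   ≤⟨ ℕP.+-mono-≤ (heavy-if-excess b i excessᵢ)
                                                                                (heavy-if-excess b j excessⱼ) ⟩
      count b (toℕ i) *ₙ W (toℕ i) +ₙ count b (toℕ j) *ₙ W (toℕ j)
                                                               ≤⟨ two-colour-load b (toℕ i) (toℕ j) (i≢j ∘ toℕ-injective) ⟩
      load L (assign P) b                                      ≤⟨ load≤D wf P b ⟩
      D                                                        ∎) (ℕP.<-irrefl refl)
      where open ℕP.≤-Reasoning

    excess-total : ∀ b → sum (excess b) ≤ₙ indicator (used b)
    excess-total b with used b in eq
    ... | true  = sum-at-most-one (excess b) (excess≤1 b) (one-excess b)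
    ... | false = ℕP.≤-reflexive (trans (sum-cong-≗ no-excess) (sum-replicate-zero n))
      where
      no-excess : ∀ i → excess b i ≡ 0
      no-excess i = trans (cong (_∸ K i) (count-unused b (toℕ i) eq)) (ℕP.0∸n≡0 (K i))

    count-split : ∀ b i → count b (toℕ i) ≤ₙ K i *ₙ indicator (has b (toℕ i)) +ₙ excess b i
    count-split b i with has b (toℕ i) in eq
    ... | true  = subst (λ t → count b (toℕ i) ≤ₙ t +ₙ excess b i) (sym (ℕP.*-identityʳ (K i)))
                    (ℕP.m≤n+m∸n (count b (toℕ i)) (K i))
    ... | false = subst (_≤ₙ K i *ₙ 0 +ₙ excess b i) (sym (count-absent b (toℕ i) eq)) z≤n

    per-bin : ∀ b → sum {n} (λ i → count b (toℕ i))
                      ≤ₙ indicator (used b) +ₙ sum {n} (λ i → K i *ₙ indicator (has b (toℕ i)))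
    per-bin b = begin
      sum {n} (λ i → count b (toℕ i))                        ≤⟨ sum-mono (count-split b) ⟩
      sum (λ i → present i +ₙ excess b i)                ≡⟨ ∑-distrib-+ present (excess b) ⟩
      sum present +ₙ sum (excess b)                      ≤⟨ ℕP.+-monoʳ-≤ (sum present) (excess-total b) ⟩
      sum present +ₙ indicator (used b)                  ≡⟨ ℕP.+-comm (sum present) _ ⟩
      indicator (used b) +ₙ sum present                  ∎
      where
      open ℕP.≤-Reasoning
      present : Fin n → ℕ
      present i = K i *ₙ indicator (has b (toℕ i))

    harmonic-count : sum {n} (λ i → colourCount L (toℕ i))
                       ≤ₙ binsUsed P +ₙ sum {n} (λ i → K i *ₙ binsWithColour P (toℕ i))
    harmonic-count = begin
      sum {n} (λ i → colourCount L (toℕ i))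
        ≡⟨ sum-cong-≗ {n} (λ i → sym (count-total (toℕ i))) ⟩
      sum {n} (λ i → sum (λ b → count b (toℕ i)))
        ≡⟨ ∑-comm (λ (i : Fin n) b → count b (toℕ i)) ⟩
      sum (λ b → sum {n} (λ i → count b (toℕ i)))
        ≤⟨ sum-mono per-bin ⟩
      sum (λ b → indicator (used b) +ₙ sum (λ i → present b i))
        ≡⟨ ∑-distrib-+ (indicator ∘ used) (λ b → sum (present b)) ⟩
      sum (indicator ∘ used) +ₙ sum (λ b → sum (present b))
        ≡⟨ cong₂ _+ₙ_ (sym binsUsed≡) (trans (∑-comm present) (sum-cong-≗ colour-term)) ⟩
      binsUsed P +ₙ sum {n} (λ i → K i *ₙ binsWithColour P (toℕ i)) ∎
      where
      open ℕP.≤-Reasoning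
      present : Fin (nbins P) → Fin n → ℕ
      present b i = K i *ₙ indicator (has b (toℕ i))
      colour-term : ∀ i → sum (λ b → present b i) ≡ K i *ₙ binsWithColour P (toℕ i)
      colour-term i = trans (sym (*-distribˡ-sum (K i) (λ b → indicator (has b (toℕ i)))))
                            (cong (K i *ₙ_) (sym (binsWithColour≡ (toℕ i))))

  -- OPT of an instance split into groups that fit into single bins, when a lower
  -- bound from a single colour c matches: c occurs (k+1)·(number of groups) times,
  -- but no bin can hold k+2 items of colour c.
  opt-of-groups : {{_ : NonZero D}} → ∀ gs → All Weighted (concat gs) → All (λ g → weight g ≤ₙ D) gs →
                  ∀ c k → D <ₙ suc (suc k) *ₙ W c → colourCount (concat gs) c ≡ length gs *ₙ suc k →
                  IsOPT (concat gs) (length gs)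
  opt-of-groups gs wf fits c k overflow total =
    (P₀ , ℕP.≤-antisym (countFin-≤ (length gs) _) (lower P₀)) , lower
    where
    P₀ : Packing (concat gs)
    P₀ = group-packing gs wf fits
    lower : (P : Packing (concat gs)) → length gs ≤ₙ binsUsed P
    lower P = ℕP.*-cancelʳ-≤ (length gs) (binsUsed P) (suc k) (begin
      length gs *ₙ suc k               ≡⟨ sym total ⟩
      colourCount (concat gs) c        ≤⟨ Bins.colour-bins P wf c (suc k) overflow ⟩
      suc k *ₙ binsUsed P              ≡⟨ ℕP.*-comm (suc k) (binsUsed P) ⟩
      binsUsed P *ₙ suc k              ∎)
      where open ℕP.≤-Reasoning

  weight-replicate : ∀ n e → weight (replicate n e) ≡ n *ₙ W (colour e)
  weight-replicate zero    e = refl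
  weight-replicate (suc n) e = cong (W (colour e) +ₙ_) (weight-replicate n e)

open +-*-Solver using (solve; _:+_; _:*_; _:-_; _:=_; con)

weighted-bound : ∀ {n} (K x y : Fin n → ℕ) (β b : ℚ) → (∀ i → ℕ→ℚ (x i) ≤ β * ℕ→ℚ (y i) + b) →
                 ℕ→ℚ (sum (λ i → K i *ₙ x i)) ≤ β * ℕ→ℚ (sum (λ i → K i *ₙ y i)) + ℕ→ℚ (sum K) * b
weighted-bound {zero} K x y β b _ =
  ℚP.≤-reflexive (solve 2 (λ β b → con 0ℚ := β :* con 0ℚ :+ con 0ℚ :* b) refl β b)
weighted-bound {suc n} K x y β b bound = begin
  ℕ→ℚ (K zero *ₙ x zero +ₙ X)
    ≡⟨ trans (ℕ→ℚ-+ (K zero *ₙ x zero) X) (cong (_+ ℕ→ℚ X) (ℕ→ℚ-* (K zero) (x zero))) ⟩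
  k * ℕ→ℚ (x zero) + ℕ→ℚ X
    ≤⟨ ℚP.+-mono-≤ (ℚP.*-monoˡ-≤-nonNeg k {{ℕ→ℚ-nonNeg (K zero)}} (bound zero))
                   (weighted-bound (K ∘ suc) (x ∘ suc) (y ∘ suc) β b (bound ∘ suc)) ⟩
  k * (β * ℕ→ℚ (y zero) + b) + (β * ℕ→ℚ Y + ℕ→ℚ C * b)
    ≡⟨ solve 6 (λ k β y b Y C → k :* (β :* y :+ b) :+ (β :* Y :+ C :* b)
                                 := β :* (k :* y :+ Y) :+ (k :+ C) :* b)
               refl k β (ℕ→ℚ (y zero)) b (ℕ→ℚ Y) (ℕ→ℚ C) ⟩
  β * (k * ℕ→ℚ (y zero) + ℕ→ℚ Y) + (k + ℕ→ℚ C) * b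
    ≡⟨ sym (cong₂ (λ s t → β * s + t * b)
             (trans (ℕ→ℚ-+ (K zero *ₙ y zero) Y) (cong (_+ ℕ→ℚ Y) (ℕ→ℚ-* (K zero) (y zero))))
             (ℕ→ℚ-+ (K zero) C)) ⟩
  β * ℕ→ℚ (K zero *ₙ y zero +ₙ Y) + ℕ→ℚ (K zero +ₙ C) * b ∎
  where
  open ℚP.≤-Reasoning
  k : ℚ
  k = ℕ→ℚ (K zero)
  X Y C : ℕ
  X = sum (λ i → K (suc i) *ₙ x (suc i))
  Y = sum (λ i → K (suc i) *ₙ y (suc i))
  C = sum (K ∘ suc)

<⇒0<difference : ∀ {c d} → c < d → 0ℚ < d - c
<⇒0<difference {c} {d} c<d = subst (_< d - c) (ℚP.+-inverseʳ c) (ℚP.+-monoˡ-< (- c) c<d)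

eventually-overtakes : ∀ {c d} (A : ℚ) → c < d → ∃ λ M → c * ℕ→ℚ M + A < d * ℕ→ℚ M
eventually-overtakes {c} {d} A c<d = M , (begin-strict
  c * m + A                ≡⟨ cong (λ t → c * m + t) (sym A/δ*δ≡A) ⟩
  c * m + (A * 1/δ) * δ    <⟨ ℚP.+-monoʳ-< (c * m) (ℚP.*-monoˡ-<-pos δ {{δ-pos}} A/δ<m) ⟩
  c * m + m * δ            ≡⟨ solve 3 (λ c d m → c :* m :+ m :* (d :- c) := d :* m) refl c d m ⟩
  d * m                    ∎)
  where
  open ℚP.≤-Reasoning
  δ : ℚ
  δ = d - c
  δ-pos : Positive δ
  δ-pos = positive (<⇒0<difference c<d)
  1/δ : ℚ
  1/δ = (1/ δ) {{ℚP.pos⇒nonZero δ {{δ-pos}}}}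
  A/δ*δ≡A : (A * 1/δ) * δ ≡ A
  A/δ*δ≡A = trans (ℚP.*-assoc A 1/δ δ)
              (trans (cong (A *_) (ℚP.*-inverseˡ δ {{ℚP.pos⇒nonZero δ {{δ-pos}}}})) (ℚP.*-identityʳ A))
  M : ℕ
  M = proj₁ (ℕ→ℚ-unbounded (A * 1/δ))
  m : ℚ
  m = ℕ→ℚ M
  A/δ<m : A * 1/δ < m
  A/δ<m = proj₂ (ℕ→ℚ-unbounded (A * 1/δ))

-- Six colours; an item of colour i has size W i / D,
-- just above 1/2, 1/3, 1/7, 1/43, 1/1807 and 1/3263443 (reciprocals of the Sylvester
-- numbers t₀ = 2, tᵢ₊₁ = tᵢ(tᵢ − 1) + 1), so that K i + 1 = tᵢ − 1 of them fit into a bin.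

D : ℕ
D = 127800683409672

W : ℕ → ℕ
W 0 = 63900341704837
W 1 = 42600227803225
W 2 = 18257240487097
W 3 = 2972108916505
W 4 = 70725336697
W 5 = 39161305
W _ = 0

K : Fin 6 → ℕ
K zero                               = 0
K (suc zero)                         = 1
K (suc (suc zero))                   = 5
K (suc (suc (suc zero)))             = 41
K (suc (suc (suc (suc zero))))       = 1805
K (suc (suc (suc (suc (suc zero))))) = 3263441

-- K i + 1 items of colour i weigh at least H > D/2.
H : ℕ
H = 63900341704837

by-evaluation : {P : Pred (Fin 6) 0ℓ} (P? : Decidable P) → {True (all? P?)} → ∀ i → P i
by-evaluation P? {t} = toWitness t

open Scaled D W

-- They are opaque so that their
-- (large) evaluated proof terms are never unfolded again.  overfull and
-- group-fits say that exactly K i + 1 items of colour i fit into a bin.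
opaque
  overfull : ∀ i → D <ₙ suc (suc (K i)) *ₙ W (toℕ i)
  overfull = by-evaluation (λ i → D ℕ.<? suc (suc (K i)) *ₙ W (toℕ i))

  heavy : ∀ i → H ≤ₙ suc (K i) *ₙ W (toℕ i)
  heavy = by-evaluation (λ i → H ℕ.≤? suc (K i) *ₙ W (toℕ i))

  two-heavy : D <ₙ H +ₙ H
  two-heavy = from-yes (D ℕ.<? H +ₙ H)

  group-fits : ∀ i → suc (K i) *ₙ W (toℕ i) ≤ₙ D
  group-fits = by-evaluation (λ i → suc (K i) *ₙ W (toℕ i) ℕ.≤? D)

  positive-size : ∀ (i : Fin 6) → 0ℚ < + W (toℕ i) / D
  positive-size = by-evaluation (λ i → 0ℚ ℚP.<? + W (toℕ i) / D)

  size-at-most-1 : ∀ (i : Fin 6) → + W (toℕ i) / D ≤ + 1 / 1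
  size-at-most-1 = by-evaluation (λ i → + W (toℕ i) / D ℚP.≤? + 1 / 1)

item-of : Fin 6 → Item
item-of i = item (+ W (toℕ i) / D) (toℕ i) (positive-size i) (size-at-most-1 i)

opaque
  item-weighted : ∀ i → Weighted (item-of i)
  item-weighted = by-evaluation (λ i → ℕ→ℚ D * size (item-of i) ℚP.≟ ℕ→ℚ (W (toℕ i)))

block : Instance
block = tabulate item-of

opaque
  block-fits : weight block ≤ₙ D
  block-fits = from-yes (weight block ℕ.≤? D)

  block-colours : ∀ (i : Fin 6) → colourCount block (toℕ i) ≡ 1
  block-colours = by-evaluation (λ i → colourCount block (toℕ i) ℕ.≟ 1)

restrict-block : ∀ i → restrict block (toℕ i) ≡ item-of i ∷ []
restrict-block zero                               = refl
restrict-block (suc zero)                         = refl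
restrict-block (suc (suc zero))                   = refl
restrict-block (suc (suc (suc zero)))             = refl
restrict-block (suc (suc (suc (suc zero))))       = refl
restrict-block (suc (suc (suc (suc (suc zero))))) = refl

instanceOf : ℕ → Instance
instanceOf N = concat (replicate N block)

instance-weighted : ∀ N → All Weighted (instanceOf N)
instance-weighted N = concat⁺ (replicate⁺ N (tabulate⁺ {f = item-of} item-weighted))

instance-colours : ∀ N (i : Fin 6) → colourCount (instanceOf N) (toℕ i) ≡ N
instance-colours N i = trans (colourCount-concat-replicate N block (toℕ i))
                             (trans (cong (N *ₙ_) (block-colours i)) (ℕP.*-identityʳ N))

restrict-instance : ∀ N i → restrict (instanceOf N) (toℕ i) ≡ replicate N (item-of i)
restrict-instance zero    i = refl
restrict-instance (suc N) i =
  trans (filter-++ (λ e → colour e ℕ.≟ toℕ i) block (instanceOf N))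
        (cong₂ _++_ (restrict-block i) (restrict-instance N i))

-- OPT(instanceOf N) = N: the blocks give N bins, and no two items of colour 0 share a bin.
opt-instance : ∀ N → IsOPT (instanceOf N) N
opt-instance N = subst (IsOPT (instanceOf N)) (length-replicate N)
  (opt-of-groups (replicate N block) (instance-weighted N) (replicate⁺ N block-fits) 0 0 (overfull zero)
    (trans (instance-colours N zero) (sym (trans (cong (_*ₙ 1) (length-replicate N)) (ℕP.*-identityʳ N)))))

-- OPT of colour class i in instanceOf (o · (K i + 1)) is o: groups of K i + 1 fill o bins.
opt-colour : ∀ i o → IsOPT (restrict (instanceOf (o *ₙ suc (K i))) (toℕ i)) o
opt-colour i o = subst₂ IsOPT (sym (trans (restrict-instance _ i) (replicate-* o (suc (K i)) (item-of i))))
                             (length-replicate o)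
  (opt-of-groups groups (concat⁺ (replicate⁺ o (replicate⁺ (suc (K i)) (item-weighted i))))
    (replicate⁺ o (subst (_≤ₙ D) (sym (weight-replicate (suc (K i)) (item-of i))) (group-fits i)))
    (toℕ i) (K i) (overfull i)
    (trans (colourCount-concat-replicate o _ (toℕ i))
           (cong₂ _*ₙ_ (sym (length-replicate o)) (colourCount-replicate (suc (K i)) (item-of i)))))
  where
  groups : List Instance
  groups = replicate o (replicate (suc (K i)) (item-of i))

counting : ∀ N (P : Packing (instanceOf N)) →
           6 *ₙ N ≤ₙ binsUsed P +ₙ sum (λ i → K i *ₙ binsWithColour P (toℕ i))
counting N P =
  subst (_≤ₙ binsUsed P +ₙ sum (λ i → K i *ₙ binsWithColour P (toℕ i))) (sum-cong-≗ {6} (instance-colours N))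
    (Harmonic.harmonic-count {6} K H overfull heavy two-heavy P (instance-weighted N))

-- Lc = lcm (K i + 1) and q i = Lc / (K i + 1): in instanceOf (M·Lc) colour class i has OPT M·q i.
Lc : ℕ
Lc = 3263442

q : Fin 6 → ℕ
q zero                               = 3263442
q (suc zero)                         = 1631721
q (suc (suc zero))                   = 543907
q (suc (suc (suc zero)))             = 77701
q (suc (suc (suc (suc zero))))       = 1807
q (suc (suc (suc (suc (suc zero))))) = 1

q-spec : ∀ i → q i *ₙ suc (K i) ≡ Lc
q-spec = by-evaluation (λ i → q i *ₙ suc (K i) ℕ.≟ Lc)

-- Tn = Σ K i · q i, the colour bins forced per Lc items of each colour.
Tn : ℕ
Tn = sum (λ i → K i *ₙ q i)

Lq Tq sixLq : ℚ
Lq    = ℕ→ℚ Lc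
Tq    = ℕ→ℚ Tn
sixLq = ℕ→ℚ (6 *ₙ Lc)

harmonic-constant : (+ 169103 / 100000) * Lq + Tq < sixLq
harmonic-constant = from-yes ((+ 169103 / 100000) * Lq + Tq ℚP.<? sixLq)

ratio-bound : ∀ α β → AllAdmitApprox α β → ¬ (α * Lq + β * Tq < sixLq)
ratio-bound α β (a , b , approx) gap =
  ℚP.<-irrefl refl (ℚP.<-≤-trans (proj₂ (eventually-overtakes A gap)) (linear-bound M))
  where
  A : ℚ
  A = ℕ→ℚ a + ℕ→ℚ (sum K) * ℕ→ℚ b
  M : ℕ
  M = proj₁ (eventually-overtakes A gap)
  linear-bound : ∀ M → sixLq * ℕ→ℚ M ≤ (α * Lq + β * Tq) * ℕ→ℚ M + A
  linear-bound M = begin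
    sixLq * m                                   ≡⟨ trans (sym (ℕ→ℚ-* (6 *ₙ Lc) M)) (cong ℕ→ℚ six-N) ⟩
    ℕ→ℚ (6 *ₙ N)                                ≤⟨ ℕ→ℚ-mono (counting N P) ⟩
    ℕ→ℚ (binsUsed P +ₙ sum colour-bins)         ≡⟨ ℕ→ℚ-+ (binsUsed P) (sum colour-bins) ⟩
    ℕ→ℚ (binsUsed P) + ℕ→ℚ (sum colour-bins)
      ≤⟨ ℚP.+-mono-≤ (proj₁ (proj₂ (approx (instanceOf N))) N (opt-instance N))
                     (weighted-bound K (λ i → binsWithColour P (toℕ i)) o β (ℕ→ℚ b) colour-bound) ⟩
    (α * ℕ→ℚ N + ℕ→ℚ a) + (β * ℕ→ℚ (sum (λ i → K i *ₙ o i)) + ℕ→ℚ (sum K) * ℕ→ℚ b)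
      ≡⟨ cong₂ (λ s t → (α * s + ℕ→ℚ a) + (β * t + ℕ→ℚ (sum K) * ℕ→ℚ b))
               (ℕ→ℚ-* M Lc) (trans (cong ℕ→ℚ colour-opt-total) (ℕ→ℚ-* M Tn)) ⟩
    (α * (m * Lq) + ℕ→ℚ a) + (β * (m * Tq) + ℕ→ℚ (sum K) * ℕ→ℚ b)
      ≡⟨ solve 7 (λ α β m L T x y → (α :* (m :* L) :+ x) :+ (β :* (m :* T) :+ y)
                                     := (α :* L :+ β :* T) :* m :+ (x :+ y))
               refl α β m Lq Tq (ℕ→ℚ a) (ℕ→ℚ (sum K) * ℕ→ℚ b) ⟩
    (α * Lq + β * Tq) * m + A                   ∎
    where
    open ℚP.≤-Reasoning
    m : ℚ
    m = ℕ→ℚ M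
    N : ℕ
    N = M *ₙ Lc
    P : Packing (instanceOf N)
    P = proj₁ (approx (instanceOf N))
    colour-bins : Fin 6 → ℕ
    colour-bins i = K i *ₙ binsWithColour P (toℕ i)
    o : Fin 6 → ℕ
    o i = M *ₙ q i
    six-N : 6 *ₙ Lc *ₙ M ≡ 6 *ₙ N
    six-N = trans (ℕP.*-assoc 6 Lc M) (cong (6 *ₙ_) (ℕP.*-comm Lc M))
    colour-opt : ∀ i → IsOPT (restrict (instanceOf N) (toℕ i)) (o i)
    colour-opt i = subst (λ n → IsOPT (restrict (instanceOf n) (toℕ i)) (o i))
                         (trans (ℕP.*-assoc M (q i) (suc (K i))) (cong (M *ₙ_) (q-spec i)))
                         (opt-colour i (o i))
    colour-bound : ∀ i → ℕ→ℚ (binsWithColour P (toℕ i)) ≤ β * ℕ→ℚ (o i) + ℕ→ℚ b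
    colour-bound i = proj₂ (proj₂ (approx (instanceOf N))) (toℕ i) (o i) (colour-opt i)
    colour-opt-total : sum (λ i → K i *ₙ o i) ≡ M *ₙ Tn
    colour-opt-total = trans (sum-cong-≗ (λ i → x∙yz≈y∙xz (K i) M (q i)))
                             (sym (*-distribˡ-sum M (λ i → K i *ₙ q i)))

-- For α < 1.69103 the inequality excluded by ratio-bound holds for β = 1 + ε,
-- ε small: take ε₀ = gap/(2Tn), where gap = 6Lc − (αLc + Tn) > 0.
stretch-margin : ∀ α → α < + 169103 / 100000 →
                 ∃ λ ε₀ → 0ℚ < ε₀ × (∀ ε → ε ≤ ε₀ → α * Lq + (1ℚ + ε) * Tq < sixLq)
stretch-margin α α<c = ε₀ , ε₀>0 , λ ε ε≤ε₀ → begin-strict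
  α * Lq + (1ℚ + ε) * Tq    ≤⟨ ℚP.+-monoʳ-≤ (α * Lq)
                                 (ℚP.*-monoʳ-≤-nonNeg Tq {{ℕ→ℚ-nonNeg Tn}} (ℚP.+-monoʳ-≤ 1ℚ ε≤ε₀)) ⟩
  α * Lq + (1ℚ + ε₀) * Tq   ≡⟨ solve 3 (λ α L g → α :* L :+ (con 1ℚ :+ g :* con 1/2Tn) :* con Tq
                                                  := α :* L :+ con Tq :+ g :* con ½) refl α Lq gap ⟩
  α * Lq + Tq + gap * ½     <⟨ ℚP.+-monoʳ-< (α * Lq + Tq) half-gap<gap ⟩
  α * Lq + Tq + gap         ≡⟨ solve 2 (λ p s → p :+ (s :- p) := s) refl (α * Lq + Tq) sixLq ⟩
  sixLq                     ∎
  where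
  open ℚP.≤-Reasoning
  gap : ℚ
  gap = sixLq - (α * Lq + Tq)
  gap-pos : Positive gap
  gap-pos = positive (<⇒0<difference (begin-strict
    α * Lq + Tq                      <⟨ ℚP.+-monoˡ-< Tq (ℚP.*-monoˡ-<-pos Lq α<c) ⟩
    (+ 169103 / 100000) * Lq + Tq    <⟨ harmonic-constant ⟩
    sixLq                            ∎))
  -- 28124146 = 2 · Tn
  ½ 1/2Tn ε₀ : ℚ
  ½      = + 1 / 2
  1/2Tn  = + 1 / 28124146
  ε₀     = gap * 1/2Tn
  ε₀>0 : 0ℚ < ε₀
  ε₀>0 = ℚP.positive⁻¹ ε₀ {{ℚP.pos*pos⇒pos gap {{gap-pos}} 1/2Tn}}
  half-gap<gap : gap * ½ < gap
  half-gap<gap = subst (gap * ½ <_) (ℚP.*-identityʳ gap)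
                   (ℚP.*-monoʳ-<-pos gap {{gap-pos}} (from-yes (½ ℚP.<? 1ℚ)))

theorem2 : (α : ℚ) → α < (+ 169103 / 100000) →
    ∃ λ (ε₀ : ℚ) → 0ℚ < ε₀ ×
      ((ε : ℚ) → 0ℚ < ε → ε ≤ ε₀ → ¬ AllAdmitApprox α (1ℚ + ε))
theorem2 α α<c =
  let ε₀ , ε₀>0 , below = stretch-margin α α<c
  in  ε₀ , ε₀>0 , λ ε _ ε≤ε₀ admits → ratio-bound α (1ℚ + ε) admits (below ε ε≤ε₀)
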